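{- Let $p$ be a prime, let $v,w\in\mathbb Z_p\setminus\{0\}$, and let $\ell,m$ be integers with $0\le \ell,m\le p-1$. Suppose there are positive integers $x\le\ell$ and $y\le m$ with $\gcd(x,y)=1$ and $xv=yw$ in $\mathbb Z_p$. Put $g=v/y=w/x\in\mathbb Z_p$. Then: (i) If $x=1$, then $\operatorname{AP}(v,\ell)+\operatorname{AP}(w,m)=\operatorname{AP}(g,m+\ell y)$; set $F=0$ and $L=m+\ell y$. (ii) If $y=1$, then symmetrically $\operatorname{AP}(v,\ell)+\operatorname{AP}(w,m)=\operatorname{AP}(g,\ell+mx)$; set $F=0$ and $L=\ell+mx$. (iii) If $x,y>1$, set $F=(x-1)(y-1)$ and $L=mx+\ell y-2F$. Then $Fg+\operatorname{AP}(g,L)\subseteq \operatorname{AP}(v,\ell)+\operatorname{AP}(w,m)$. Moreover, in every case, each integer $t$ with $0\le t\le L$ can be written as $F+t=\alpha y+\beta x$ with integers $0\le\alpha\le\ell$ and $0\le\beta\le m$. Finally, if $L\ge p-1$ then $\operatorname{AP}(g,p-1)=\mathbb Z_p$.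
   Context: For $u\in\mathbb Z_p$ and a nonnegative integer $L$, $\operatorname{AP}(u,L)=\{0,u,2u,\ldots,Lu\}\subseteq\mathbb Z_p$. Sums of subsets of $\mathbb Z_p$ are Minkowski sums, $A+B=\{a+b:a\in A,b\in B\}$, and $c+A=\{c+a:a\in A\}$. -}

module Defs where

open import Data.Nat using (ℕ; zero; suc; _+_; _*_; _∸_; _≤_; NonZero)
open import Data.Nat.DivMod using (_mod_)
open import Data.Fin using (Fin; toℕ)
open import Data.Product using (Σ; ∃; _×_; _,_)
open import Function.Bundles using (_⇔_)
open import Relation.Binary.PropositionalEquality using (_≡_)

ℤ_ : (p : ℕ) → Set
ℤ_ p = Fin p

module _ {p : ℕ} .{{_ : NonZero p}} where

  infixl 6 _+ₚ_
  infixl 7 _·ₚ_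

  _+ₚ_ : Fin p → Fin p → Fin p
  a +ₚ b = (toℕ a + toℕ b) mod p

  _·ₚ_ : ℕ → Fin p → Fin p
  k ·ₚ u = (k * toℕ u) mod p

  Subset : Set₁
  Subset = Fin p → Set

  AP : Fin p → ℕ → Subset
  AP u L z = Σ ℕ λ k → k ≤ L × z ≡ k ·ₚ u

  _⊕_ : Subset → Subset → Subset
  (A ⊕ B) z = Σ (Fin p) λ a → Σ (Fin p) λ b → A a × B b × z ≡ a +ₚ b

  _⊕ᶜ_ : Fin p → Subset → Subset
  (c ⊕ᶜ A) z = Σ (Fin p) λ a → A a × z ≡ c +ₚ a

  _≐_ : Subset → Subset → Set
  A ≐ B = ∀ z → A z ⇔ B z

  _⊆_ : Subset → Subset → Set
  A ⊆ B = ∀ z → A z → B z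

Representable : (x y ℓ m F L : ℕ) → Set
Representable x y ℓ m F L =
  ∀ t → t ≤ L → Σ ℕ λ α → Σ ℕ λ β → α ≤ ℓ × β ≤ m × F + t ≡ α * y + β * x

-- Given F ≤ n and n + F ≤ m x + ℓ y, choose α < x with α y ≡ n (mod x);
-- as α y ≤ (x − 1) y < n + x, this gives n = α y + β x with β ≥ 0. Then trade (α, β) for
-- (α + x, β − y) while β > m: since x + F = (x − 1) y + 1, the bound on n keeps α ≤ ℓ.
-- The cases x = 1 and y = 1 are the instances with F = 0, and AP(g, p − 1) is all of ℤ_p
-- because g is invertible modulo the prime p.
module Submission where

open import Data.Fin using (Fin; toℕ)
open import Data.Fin.Properties using (toℕ-injective; toℕ<n; toℕ-fromℕ<)
open import Data.Nat
open import Data.Nat.Coprimality using (Coprime; coprime-Bézout; gcd≡1⇒coprime; prime⇒coprime; 1-coprimeTo)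
open import Data.Nat.DivMod
open import Data.Nat.GCD using (gcd; module Bézout)
open import Data.Nat.Induction using (<-wellFounded)
open import Data.Nat.Primality using (Prime)
open import Data.Nat.Properties
open import Data.Nat.Tactic.RingSolver using (solve-∀)
open import Data.Product using (Σ; ∃-syntax; _×_; _,_)
open import Function.Bundles using (mk⇔)
open import Induction.WellFounded using (Acc; acc)
open import Relation.Binary.PropositionalEquality
open import Relation.Nullary using (yes; no)

open import Defs

BoundedCombination : (x y ℓ m n : ℕ) → Set
BoundedCombination x y ℓ m n =
  Σ ℕ λ α → Σ ℕ λ β → α ≤ ℓ × β ≤ m × n ≡ α * y + β * x

BoundedCombination-≤ : ∀ {x y ℓ m n} → BoundedCombination x y ℓ m n → n ≤ m * x + ℓ * y
BoundedCombination-≤ {x} {y} {ℓ} {m} (α , β , α≤ℓ , β≤m , refl) =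
  ≤-trans (+-mono-≤ (*-monoˡ-≤ y α≤ℓ) (*-monoˡ-≤ x β≤m)) (≤-reflexive (+-comm (ℓ * y) (m * x)))

Representable-swap : ∀ {x y ℓ m F L} → Representable x y ℓ m F L → Representable y x m ℓ F L
Representable-swap {x} {y} rep t t≤L with rep t t≤L
... | α , β , α≤ℓ , β≤m , eq = β , α , β≤m , α≤ℓ , trans eq (+-comm (α * y) (β * x))

coprime⇒%-inverse : ∀ {d a} .{{_ : NonZero d}} → Coprime d a → ∃[ c ] (c * a) % d ≡ 1 % d
coprime⇒%-inverse {d} {a} cop with coprime-Bézout cop
... | Bézout.-+ u c 1+ud≡ca = c , (begin
  (c * a) % d          ≡⟨ cong (_% d) 1+ud≡ca ⟨
  (1 + u * d) % d      ≡⟨ [m+kn]%n≡m%n 1 u d ⟩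
  1 % d                ∎)
  where open ≡-Reasoning
-- Here c a ≡ −1 (mod d), so c (d − 1) is an inverse.
coprime⇒%-inverse {d@(suc e)} {a} cop | Bézout.+- u c 1+ca≡ud = c * e , (begin
  (c * e * a) % d            ≡⟨ [m+kn]%n≡m%n (c * e * a) 1 d ⟨
  (c * e * a + 1 * d) % d    ≡⟨ cong (_% d) (rearrange c e a) ⟩
  (1 + (1 + c * a) * e) % d  ≡⟨ cong (λ r → (1 + r * e) % d) 1+ca≡ud ⟩
  (1 + u * d * e) % d        ≡⟨ cong (λ r → (1 + r) % d) (swap-last u d e) ⟩
  (1 + u * e * d) % d        ≡⟨ [m+kn]%n≡m%n 1 (u * e) d ⟩
  1 % d                      ∎)
  where
  open ≡-Reasoning
  rearrange : ∀ c e a → c * e * a + 1 * suc e ≡ 1 + (1 + c * a) * e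
  rearrange = solve-∀
  swap-last : ∀ u d e → u * d * e ≡ u * e * d
  swap-last = solve-∀

module _ {d : ℕ} .{{_ : NonZero d}} where

  *-congˡ-% : ∀ a {b c} → b % d ≡ c % d → (a * b) % d ≡ (a * c) % d
  *-congˡ-% a {b} {c} b≡c = begin
    (a * b) % d                ≡⟨ %-distribˡ-* a b d ⟩
    ((a % d) * (b % d)) % d    ≡⟨ cong (λ r → ((a % d) * r) % d) b≡c ⟩
    ((a % d) * (c % d)) % d    ≡⟨ %-distribˡ-* a c d ⟨
    (a * c) % d                ∎
    where open ≡-Reasoning

  coprime⇒%-solvable : ∀ {a} → Coprime d a → ∀ b → ∃[ k ] k < d × (k * a) % d ≡ b % d
  coprime⇒%-solvable {a} cop b with coprime⇒%-inverse cop
  ... | c , ca≡1 = (b * c) % d , m%n<n (b * c) d , (begin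
    ((b * c) % d * a) % d    ≡⟨ cong (_% d) (*-comm ((b * c) % d) a) ⟩
    (a * ((b * c) % d)) % d  ≡⟨ *-congˡ-% a (m%n%n≡m%n (b * c) d) ⟩
    (a * (b * c)) % d        ≡⟨ cong (_% d) (regroup a b c) ⟩
    (b * (c * a)) % d        ≡⟨ *-congˡ-% b ca≡1 ⟩
    (b * 1) % d              ≡⟨ cong (_% d) (*-identityʳ b) ⟩
    b % d                    ∎)
    where
    open ≡-Reasoning
    regroup : ∀ a b c → a * (b * c) ≡ b * (c * a)
    regroup = solve-∀

  %≡∧<+⇒≡+* : ∀ {a b} → a % d ≡ b % d → a < b + d → ∃[ q ] b ≡ a + q * d
  %≡∧<+⇒≡+* {a} {b} a≡b a<b+d = q , (begin-equality
    b                                ≡⟨ m≡m%n+[m/n]*n b d ⟩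
    b % d + b / d * d                ≡⟨ cong₂ (λ r s → r + s * d) a≡b (m+[n∸m]≡n a/d≤b/d) ⟨
    a % d + (a / d + q) * d          ≡⟨ regroup (a % d) (a / d) q d ⟩
    (a % d + a / d * d) + q * d      ≡⟨ cong (_+ q * d) (m≡m%n+[m/n]*n a d) ⟨
    a + q * d                        ∎)
    where
    open ≤-Reasoning
    regroup : ∀ r s t d → r + (s + t) * d ≡ (r + s * d) + t * d
    regroup = solve-∀
    q : ℕ
    q = b / d ∸ a / d
    a/d≤b/d : a / d ≤ b / d
    a/d≤b/d = <⇒≤pred (*-cancelʳ-< d (a / d) (suc (b / d)) (+-cancelˡ-< (a % d) _ _ (begin-strict
      a % d + a / d * d      ≡⟨ m≡m%n+[m/n]*n a d ⟨
      a                      <⟨ a<b+d ⟩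
      b + d                  ≡⟨ cong (_+ d) (m≡m%n+[m/n]*n b d) ⟩
      b % d + b / d * d + d  ≡⟨ cong (λ r → r + b / d * d + d) a≡b ⟨
      a % d + b / d * d + d  ≡⟨ +-assoc (a % d) (b / d * d) d ⟩
      a % d + (b / d * d + d) ≡⟨ cong (a % d +_) (+-comm (b / d * d) d) ⟩
      a % d + suc (b / d) * d ∎)))

exchange-≡ : ∀ {x y α β} → y ≤ β → α * y + β * x ≡ (α + x) * y + (β ∸ y) * x
exchange-≡ {x} {y} {α} {β} y≤β = begin
  α * y + β * x              ≡⟨ cong (λ b → α * y + b * x) (m∸n+n≡m y≤β) ⟨
  α * y + (β ∸ y + y) * x    ≡⟨ regroup α y (β ∸ y) x ⟩
  (α + x) * y + (β ∸ y) * x  ∎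
  where
  open ≡-Reasoning
  regroup : ∀ α y b x → α * y + (b + y) * x ≡ (α + x) * y + b * x
  regroup = solve-∀

exchange-room : ∀ x y {ℓ m n α β} .{{_ : NonZero x}} .{{_ : NonZero y}} →
  n + (x ∸ 1) * (y ∸ 1) ≤ m * x + ℓ * y → n ≡ α * y + β * x → m < β → α + x ≤ ℓ
exchange-room x@(suc x1) y@(suc y1) {ℓ} {m} {_} {α} {β} bound refl m<β =
  subst (_≤ ℓ) (sym (+-suc α x1))
    (*-cancelʳ-< y (α + x1) ℓ (+-cancelˡ-< (m * x) _ _ (begin
      suc (m * x + (α + x1) * y)  ≡⟨ regroup m x1 y1 α ⟩
      α * y + suc m * x + x1 * y1  ≤⟨ +-monoˡ-≤ (x1 * y1) (+-monoʳ-≤ (α * y) (*-monoˡ-≤ x m<β)) ⟩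
      α * y + β * x + x1 * y1      ≤⟨ bound ⟩
      m * x + ℓ * y                ∎)))
  where
  open ≤-Reasoning
  regroup : ∀ m x1 y1 α →
    suc (m * suc x1 + (α + x1) * suc y1) ≡ α * suc y1 + suc m * suc x1 + x1 * y1
  regroup = solve-∀

exchange⇒BoundedCombination : ∀ x y {ℓ m n} .{{_ : NonZero x}} .{{_ : NonZero y}} → y ≤ m →
  n + (x ∸ 1) * (y ∸ 1) ≤ m * x + ℓ * y →
  ∀ α β → α ≤ ℓ → n ≡ α * y + β * x → BoundedCombination x y ℓ m n
exchange⇒BoundedCombination x y {ℓ} {m} {n} y≤m bound α β = go α β (<-wellFounded β)
  where
  go : ∀ α β → Acc _<_ β → α ≤ ℓ → n ≡ α * y + β * x → BoundedCombination x y ℓ m n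
  go α β (acc rec) α≤ℓ n≡ with β ≤? m
  ... | yes β≤m = α , β , α≤ℓ , β≤m , n≡
  ... | no β≰m = go (α + x) (β ∸ y) (rec (∸-monoʳ-< (>-nonZero⁻¹ y) y≤β))
                   (exchange-room x y bound n≡ m<β) (trans n≡ (exchange-≡ {x} {y} {α} y≤β))
    where
    m<β : m < β
    m<β = ≰⇒> β≰m
    y≤β : y ≤ β
    y≤β = ≤-trans y≤m (<⇒≤ m<β)

coprime⇒Representable : ∀ x y {ℓ m} .{{_ : NonZero x}} .{{_ : NonZero y}} → Coprime x y → x ≤ ℓ → y ≤ m →
  Representable x y ℓ m ((x ∸ 1) * (y ∸ 1)) (m * x + ℓ * y ∸ 2 * ((x ∸ 1) * (y ∸ 1)))
coprime⇒Representable x@(suc x1) y@(suc y1) {ℓ} {m} cop x≤ℓ y≤m t t≤L =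
  from-residue (coprime⇒%-solvable cop n)
  where
  open ≤-Reasoning
  F : ℕ
  F = x1 * y1
  n : ℕ
  n = F + t

  2F≤mx+ℓy : 2 * F ≤ m * x + ℓ * y
  2F≤mx+ℓy = begin
    2 * F          ≡⟨ cong (F +_) (+-identityʳ F) ⟩
    F + F          ≤⟨ +-mono-≤ (≤-trans (≤-reflexive (*-comm x1 y1)) (*-mono-≤ (≤-trans (n≤1+n y1) y≤m) (n≤1+n x1)))
                               (*-mono-≤ (≤-trans (n≤1+n x1) x≤ℓ) (n≤1+n y1)) ⟩
    m * x + ℓ * y  ∎

  n+F≤mx+ℓy : n + F ≤ m * x + ℓ * y
  n+F≤mx+ℓy = begin
    F + t + F                          ≡⟨ regroup F t ⟩
    t + 2 * F                          ≤⟨ +-monoˡ-≤ (2 * F) t≤L ⟩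
    m * x + ℓ * y ∸ 2 * F + 2 * F      ≡⟨ m∸n+n≡m 2F≤mx+ℓy ⟩
    m * x + ℓ * y                      ∎
    where
    regroup : ∀ F t → F + t + F ≡ t + 2 * F
    regroup = solve-∀

  from-residue : ∃[ α ] α < x × (α * y) % x ≡ n % x → BoundedCombination x y ℓ m n
  from-residue (α , α<x , αy≡n) with %≡∧<+⇒≡+* αy≡n αy<n+x
    where
    αy<n+x : α * y < n + x
    αy<n+x = begin-strict
      α * y      ≤⟨ *-monoˡ-≤ y (<⇒≤pred α<x) ⟩
      x1 * y     ≡⟨ trans (*-suc x1 y1) (+-comm x1 F) ⟩
      F + x1     <⟨ +-monoʳ-< F (n<1+n x1) ⟩
      F + x      ≤⟨ +-monoˡ-≤ x (m≤m+n F t) ⟩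
      n + x      ∎
  ... | β , n≡αy+βx =
    exchange⇒BoundedCombination x y y≤m n+F≤mx+ℓy α β (≤-trans (<⇒≤ α<x) x≤ℓ) n≡αy+βx

1-Representable : ∀ y {ℓ m} .{{_ : NonZero y}} → 1 ≤ ℓ → y ≤ m → Representable 1 y ℓ m 0 (m + ℓ * y)
1-Representable y {ℓ} {m} 1≤ℓ y≤m =
  subst (Representable 1 y ℓ m 0) (cong (_+ ℓ * y) (*-identityʳ m)) (coprime⇒Representable 1 y (1-coprimeTo y) 1≤ℓ y≤m)

module _ {p : ℕ} .{{_ : NonZero p}} where

  toℕ-mod : ∀ n → toℕ (n mod p) ≡ n % p
  toℕ-mod n = toℕ-fromℕ< (m%n<n n p)

  ·ₚ-assoc : ∀ a b (g : Fin p) → a ·ₚ (b ·ₚ g) ≡ (a * b) ·ₚ g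
  ·ₚ-assoc a b g = toℕ-injective (begin
    toℕ (a ·ₚ (b ·ₚ g))           ≡⟨ toℕ-mod _ ⟩
    (a * toℕ (b ·ₚ g)) % p        ≡⟨ *-congˡ-% a (trans (cong (_% p) (toℕ-mod _)) (m%n%n≡m%n _ p)) ⟩
    (a * (b * toℕ g)) % p         ≡⟨ cong (_% p) (*-assoc a b (toℕ g)) ⟨
    (a * b * toℕ g) % p           ≡⟨ toℕ-mod _ ⟨
    toℕ ((a * b) ·ₚ g)            ∎)
    where open ≡-Reasoning

  ·ₚ-distribʳ-+ₚ : ∀ a b (g : Fin p) → a ·ₚ g +ₚ b ·ₚ g ≡ (a + b) ·ₚ g
  ·ₚ-distribʳ-+ₚ a b g = toℕ-injective (begin
    toℕ (a ·ₚ g +ₚ b ·ₚ g)                     ≡⟨ toℕ-mod _ ⟩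
    (toℕ (a ·ₚ g) + toℕ (b ·ₚ g)) % p          ≡⟨ cong₂ (λ r s → (r + s) % p) (toℕ-mod _) (toℕ-mod _) ⟩
    ((a * toℕ g) % p + (b * toℕ g) % p) % p    ≡⟨ %-distribˡ-+ (a * toℕ g) (b * toℕ g) p ⟨
    (a * toℕ g + b * toℕ g) % p                ≡⟨ cong (_% p) (*-distribʳ-+ (toℕ g) a b) ⟨
    ((a + b) * toℕ g) % p                      ≡⟨ toℕ-mod _ ⟨
    toℕ ((a + b) ·ₚ g)                         ∎)
    where open ≡-Reasoning

  ·ₚ-zeroʳ : ∀ k {g : Fin p} → toℕ g ≡ 0 → toℕ (k ·ₚ g) ≡ 0
  ·ₚ-zeroʳ k {g} g≡0 = begin
    toℕ (k ·ₚ g)     ≡⟨ toℕ-mod _ ⟩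
    (k * toℕ g) % p  ≡⟨ cong (λ r → (k * r) % p) g≡0 ⟩
    (k * 0) % p      ≡⟨ cong (_% p) (*-zeroʳ k) ⟩
    0 % p            ≡⟨ m<n⇒m%n≡m (>-nonZero⁻¹ p) ⟩
    0                ∎
    where open ≡-Reasoning

  AP-full : Prime p → (g : Fin p) → toℕ g ≢ 0 → ∀ z → AP g (p ∸ 1) z
  AP-full p-prime g g≢0 z with coprime⇒%-solvable (prime⇒coprime p-prime {{≢-nonZero g≢0}} (toℕ<n g)) (toℕ z)
  ... | k , k<p , kg≡z = k , <⇒≤pred k<p , toℕ-injective (begin
    toℕ z            ≡⟨ m<n⇒m%n≡m (toℕ<n z) ⟨
    toℕ z % p        ≡⟨ kg≡z ⟨
    (k * toℕ g) % p  ≡⟨ toℕ-mod _ ⟨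
    toℕ (k ·ₚ g)     ∎)
    where open ≡-Reasoning

  module _ {x y ℓ m : ℕ} {v w g : Fin p} (yg≡v : y ·ₚ g ≡ v) (xg≡w : x ·ₚ g ≡ w) where

    αv+βw≡[αy+βx]g : ∀ α β → α ·ₚ v +ₚ β ·ₚ w ≡ (α * y + β * x) ·ₚ g
    αv+βw≡[αy+βx]g α β = begin
      α ·ₚ v +ₚ β ·ₚ w                  ≡⟨ cong₂ (λ a b → α ·ₚ a +ₚ β ·ₚ b) yg≡v xg≡w ⟨
      α ·ₚ (y ·ₚ g) +ₚ β ·ₚ (x ·ₚ g)    ≡⟨ cong₂ _+ₚ_ (·ₚ-assoc α y g) (·ₚ-assoc β x g) ⟩
      (α * y) ·ₚ g +ₚ (β * x) ·ₚ g      ≡⟨ ·ₚ-distribʳ-+ₚ (α * y) (β * x) g ⟩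
      (α * y + β * x) ·ₚ g              ∎
      where open ≡-Reasoning

    BoundedCombination⇒∈⊕ : ∀ {n} → BoundedCombination x y ℓ m n → (AP v ℓ ⊕ AP w m) (n ·ₚ g)
    BoundedCombination⇒∈⊕ (α , β , α≤ℓ , β≤m , refl) =
      α ·ₚ v , β ·ₚ w , (α , α≤ℓ , refl) , (β , β≤m , refl) , sym (αv+βw≡[αy+βx]g α β)

    ∈⊕⇒BoundedCombination : ∀ {z} → (AP v ℓ ⊕ AP w m) z →
      ∃[ n ] BoundedCombination x y ℓ m n × z ≡ n ·ₚ g
    ∈⊕⇒BoundedCombination (_ , _ , (α , α≤ℓ , refl) , (β , β≤m , refl) , refl) =
      α * y + β * x , (α , β , α≤ℓ , β≤m , refl) , αv+βw≡[αy+βx]g α β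

    Representable⇒⊕ᶜ⊆⊕ : ∀ {F L} → Representable x y ℓ m F L → ((F ·ₚ g) ⊕ᶜ AP g L) ⊆ (AP v ℓ ⊕ AP w m)
    Representable⇒⊕ᶜ⊆⊕ {F} rep _ (_ , (k , k≤L , refl) , refl) =
      subst (AP v ℓ ⊕ AP w m) (sym (·ₚ-distribʳ-+ₚ F k g)) (BoundedCombination⇒∈⊕ (rep k k≤L))

    Representable⇒⊕≐AP : ∀ {L} → Representable x y ℓ m 0 L → m * x + ℓ * y ≤ L →
      (AP v ℓ ⊕ AP w m) ≐ AP g L
    Representable⇒⊕≐AP {L} rep mx+ℓy≤L z = mk⇔ to from
      where
      to : (AP v ℓ ⊕ AP w m) z → AP g L z
      to z∈ with ∈⊕⇒BoundedCombination z∈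
      ... | n , n∈ , z≡ng = n , ≤-trans (BoundedCombination-≤ n∈) mx+ℓy≤L , z≡ng
      from : AP g L z → (AP v ℓ ⊕ AP w m) z
      from (k , k≤L , refl) = BoundedCombination⇒∈⊕ (rep k k≤L)

lemma3 : (p : ℕ) .{{_ : NonZero p}} → Prime p →
    (v w : Fin p) → toℕ v ≢ 0 → toℕ w ≢ 0 →
    (ℓ m : ℕ) → ℓ ≤ p ∸ 1 → m ≤ p ∸ 1 →
    (x y : ℕ) → 1 ≤ x → x ≤ ℓ → 1 ≤ y → y ≤ m → gcd x y ≡ 1 →
    x ·ₚ v ≡ y ·ₚ w →
    (g : Fin p) → y ·ₚ g ≡ v → x ·ₚ g ≡ w →
    (x ≡ 1 →
      ((AP v ℓ ⊕ AP w m) ≐ AP g (m + ℓ * y))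
      × Representable x y ℓ m 0 (m + ℓ * y)
      × (p ∸ 1 ≤ m + ℓ * y → ∀ z → AP g (p ∸ 1) z))
    × (y ≡ 1 →
      ((AP v ℓ ⊕ AP w m) ≐ AP g (ℓ + m * x))
      × Representable x y ℓ m 0 (ℓ + m * x)
      × (p ∸ 1 ≤ ℓ + m * x → ∀ z → AP g (p ∸ 1) z))
    × (1 < x → 1 < y →
      ((((x ∸ 1) * (y ∸ 1)) ·ₚ g) ⊕ᶜ AP g (m * x + ℓ * y ∸ 2 * ((x ∸ 1) * (y ∸ 1))))
        ⊆ (AP v ℓ ⊕ AP w m)
      × Representable x y ℓ m ((x ∸ 1) * (y ∸ 1)) (m * x + ℓ * y ∸ 2 * ((x ∸ 1) * (y ∸ 1)))
      × (p ∸ 1 ≤ m * x + ℓ * y ∸ 2 * ((x ∸ 1) * (y ∸ 1)) → ∀ z → AP g (p ∸ 1) z))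
lemma3 p p-prime v _ v≢0 _ ℓ m _ _ x y 1≤x x≤ℓ 1≤y y≤m gcd≡1 _ g yg≡v xg≡w =
  (λ { refl → let rep = 1-Representable y x≤ℓ y≤m in
         Representable⇒⊕≐AP yg≡v xg≡w rep (≤-reflexive (cong (_+ ℓ * y) (*-identityʳ m))) , rep , AP-g-full }) ,
  (λ { refl → let rep = Representable-swap (1-Representable x y≤m x≤ℓ) in
         Representable⇒⊕≐AP yg≡v xg≡w rep (≤-reflexive mx+ℓ*1≡ℓ+mx) , rep , AP-g-full }) ,
  (λ _ _ → let rep = coprime⇒Representable x y (gcd≡1⇒coprime gcd≡1) x≤ℓ y≤m in
         Representable⇒⊕ᶜ⊆⊕ yg≡v xg≡w rep , rep , AP-g-full)
  where
  instance
    x-nonZero : NonZero x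
    x-nonZero = >-nonZero 1≤x
    y-nonZero : NonZero y
    y-nonZero = >-nonZero 1≤y
  mx+ℓ*1≡ℓ+mx : m * x + ℓ * 1 ≡ ℓ + m * x
  mx+ℓ*1≡ℓ+mx = trans (cong (m * x +_) (*-identityʳ ℓ)) (+-comm (m * x) ℓ)
  g≢0 : toℕ g ≢ 0
  g≢0 g≡0 = v≢0 (subst (λ u → toℕ u ≡ 0) yg≡v (·ₚ-zeroʳ y g≡0))
  AP-g-full : ∀ {L} → p ∸ 1 ≤ L → ∀ z → AP g (p ∸ 1) z
  AP-g-full _ = AP-full p-prime g g≢0
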